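{- Let $f = x^2 + k$ with $k \in \mathbb{Z} \setminus \{0, -1\}$, and put $t_n = f^n(0)$ for $n \geq 1$. Then $(t_n)_{n \geq 1}$ is a rigid divisibility sequence: for every prime $p$ and every $n \geq 1$, if $v_p(t_n) > 0$ then $v_p(t_{mn}) = v_p(t_n)$ for all $m \geq 1$.
   Context: $f^n$ denotes the $n$-th iterate of $f$ under composition; $v_p$ is the $p$-adic valuation. -}

module Defs where

open import Data.Nat using (ℕ; zero; suc; _^_)
open import Data.Integer using (ℤ; +_; _+_; _*_)
open import Data.Integer.Divisibility using (_∣_)
open import Data.Product using (_×_)
open import Relation.Nullary using (¬_)

f : ℤ → ℤ → ℤ
f k x = x * x + k

t : ℤ → ℕ → ℤ
t k zero    = + 0
t k (suc n) = f k (t k n)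

-- p-adic valuation as a relation: v_p(x) = e  iff  p^e ∣ x and p^(e+1) ∤ x
-- (only holds for x ≠ 0, where v_p is finite)
Val : ℕ → ℤ → ℕ → Set
Val p x e = ((+ (p ^ e)) ∣ x) × ¬ ((+ (p ^ suc e)) ∣ x)

-- Since f x − f y = (x − y)(x + y), every iterate of f preserves congruences,
-- and f x ≡ f 0 (mod x²); hence t_{i+j} = fⁱ(t_j) ≡ fⁱ(0) = tᵢ (mod t_j²) for i ≥ 1. If pᵉ ∣ tₙ
-- with e ≥ 1, induction on m gives pᵉ ∣ t_{mn}, so p^{e+1} ∣ p^{2e} ∣ t_{mn}² ∣ t_{(m+1)n} − tₙ, and
-- whether v_p(x) = e depends only on x modulo p^{e+1}.
module Submission where

open import Defs
open import Data.Nat using (ℕ; _*_; _≥_; _>_)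
open import Data.Nat.Primality using (Prime)
open import Data.Integer using (ℤ; +_; -[1+_])
open import Relation.Binary.PropositionalEquality using (_≢_)

open import Data.Nat as ℕ using (zero; suc; _^_)
open import Data.Nat.GeneralisedArithmetic using (iterate)
import Data.Nat.Properties as ℕ
import Data.Nat.Divisibility as ℕ
open import Data.Integer as ℤ using (_-_)
open import Data.Integer.Properties as ℤ using (neg-involutive)
open import Data.Integer.Divisibility.Signed
open import Data.Integer.Solver using (module +-*-Solver)
open import Data.Product using (_,_)
open import Relation.Binary.PropositionalEquality using (_≡_; refl; sym; trans; cong; subst; subst₂)

∣m-n∣n⇒∣m : ∀ {d m n} → d ∣ m - n → d ∣ n → d ∣ m
∣m-n∣n⇒∣m d∣m-n d∣n = ∣m+n∣n⇒∣m d∣m-n (∣m⇒∣-m d∣n)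

∣m-n∣m⇒∣n : ∀ {d m n} → d ∣ m - n → d ∣ m → d ∣ n
∣m-n∣m⇒∣n {d} d∣m-n d∣m = subst (d ∣_) (neg-involutive _) (∣m⇒∣-m (∣m+n∣m⇒∣n d∣m-n d∣m))

∣0 : ∀ d → d ∣ + 0
∣0 d = ∣ᵤ⇒∣ (ℤ.∣ d ∣ ℕ.∣0)

∣⇒sq∣sq : ∀ {d x} → d ∣ x → d ℤ.* d ∣ x ℤ.* x
∣⇒sq∣sq {d} {x} d∣x = ∣-trans (*-monoˡ-∣ d {d} {x} d∣x) (*-monoʳ-∣ x {d} {x} d∣x)

^-suc∣^-sq : ∀ p e → + (p ^ suc (suc e)) ∣ + (p ^ suc e) ℤ.* + (p ^ suc e)
^-suc∣^-sq p e = subst (+ (p ^ suc (suc e)) ∣_) (ℤ.pos-* (p ^ suc e) (p ^ suc e))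
  (∣ᵤ⇒∣ {+ _} {+ _} (ℕ.*-monoˡ-∣ (p ^ suc e) (ℕ.m∣m*n {p} (p ^ e))))

Val-cong : ∀ {p x y e} → + (p ^ suc e) ∣ y - x → Val p x e → Val p y e
Val-cong {p} {x} {y} {e} pᵉ⁺¹∣y-x (pᵉ∣x , pᵉ⁺¹∤x) =
  ∣⇒∣ᵤ (∣m-n∣n⇒∣m {m = y} {x} pᵉ∣y-x (∣ᵤ⇒∣ {k = + (p ^ e)} pᵉ∣x)) ,
  λ pᵉ⁺¹∣y → pᵉ⁺¹∤x (∣⇒∣ᵤ (∣m-n∣m⇒∣n {m = y} {x} pᵉ⁺¹∣y-x (∣ᵤ⇒∣ {k = + (p ^ suc e)} pᵉ⁺¹∣y)))
  where
  pᵉ∣y-x : + (p ^ e) ∣ y - x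
  pᵉ∣y-x = ∣-trans (∣ᵤ⇒∣ (ℕ.n∣m*n p)) pᵉ⁺¹∣y-x

iterate-suc : ∀ {A : Set} (g : A → A) x n → iterate g x (suc n) ≡ g (iterate g x n)
iterate-suc g x zero    = refl
iterate-suc g x (suc n) = iterate-suc g (g x) n

t-+ : ∀ k i j → t k (i ℕ.+ j) ≡ iterate (f k) (t k j) i
t-+ k zero    j = refl
t-+ k (suc i) j = trans (cong (f k) (t-+ k i j)) (sym (iterate-suc (f k) (t k j) i))

t≡iterate : ∀ k n → t k n ≡ iterate (f k) (+ 0) n
t≡iterate k n = trans (cong (t k) (sym (ℕ.+-identityʳ n))) (t-+ k n 0)

f-sub-f : ∀ k x y → f k x - f k y ≡ (x - y) ℤ.* (x ℤ.+ y)
f-sub-f = solve 3 (λ k x y → (x :* x :+ k) :- (y :* y :+ k) := (x :- y) :* (x :+ y)) refl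
  where open +-*-Solver

f-sub-f0 : ∀ k x → f k x - f k (+ 0) ≡ x ℤ.* x
f-sub-f0 = solve 2 (λ k x → (x :* x :+ k) :- (con (+ 0) :* con (+ 0) :+ k) := x :* x) refl
  where open +-*-Solver

iterate-f-resp-∣-sub : ∀ k {d} n {x y} → d ∣ x - y → d ∣ iterate (f k) x n - iterate (f k) y n
iterate-f-resp-∣-sub k zero    d∣x-y = d∣x-y
iterate-f-resp-∣-sub k {d} (suc n) {x} {y} d∣x-y =
  iterate-f-resp-∣-sub k n (subst (d ∣_) (sym (f-sub-f k x y)) (∣m⇒∣m*n (x ℤ.+ y) d∣x-y))

t-sq∣t-+-sub-t : ∀ k i j → t k j ℤ.* t k j ∣ t k (suc i ℕ.+ j) - t k (suc i)
t-sq∣t-+-sub-t k i j = subst₂ (λ u v → t k j ℤ.* t k j ∣ u - v)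
  (sym (t-+ k (suc i) j)) (sym (t≡iterate k (suc i)))
  (iterate-f-resp-∣-sub k i (∣-reflexive (sym (f-sub-f0 k (t k j)))))

∣t⇒∣t-* : ∀ k {d} n m → d ∣ t k n → d ∣ t k (m * n)
∣t⇒∣t-* k {d} zero    m _ = subst (λ i → d ∣ t k i) (sym (ℕ.*-zeroʳ m)) (∣0 d)
∣t⇒∣t-* k {d} (suc n) zero _ = ∣0 d
∣t⇒∣t-* k {d} (suc n) (suc m) d∣tₙ = ∣m-n∣n⇒∣m
  (∣-trans (∣m⇒∣m*n _ d∣tₘₙ) (t-sq∣t-+-sub-t k n (m * suc n))) d∣tₙ
  where
  d∣tₘₙ : d ∣ t k (m * suc n)
  d∣tₘₙ = ∣t⇒∣t-* k (suc n) m d∣tₙ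

lemma5p3 : (k : ℤ) → k ≢ + 0 → k ≢ -[1+ 0 ] →
           (p : ℕ) → Prime p → (n : ℕ) → n ≥ 1 → (e : ℕ) → e > 0 →
           Val p (t k n) e → (m : ℕ) → m ≥ 1 → Val p (t k (m * n)) e
lemma5p3 k _ _ p _ n@(suc n′) _ e@(suc e′) _ vₚ@(pᵉ∣tₙ , _) (suc m) _ =
  Val-cong {p} {t k n} {t k (suc m * n)} {e} pᵉ⁺¹∣tₘ₊₁ₙ-tₙ vₚ
  where
  pᵉ∣tₘₙ : + (p ^ e) ∣ t k (m * n)
  pᵉ∣tₘₙ = ∣t⇒∣t-* k n m (∣ᵤ⇒∣ {k = + (p ^ e)} pᵉ∣tₙ)

  pᵉ⁺¹∣tₘ₊₁ₙ-tₙ : + (p ^ suc e) ∣ t k (suc m * n) - t k n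
  pᵉ⁺¹∣tₘ₊₁ₙ-tₙ = ∣-trans (^-suc∣^-sq p e′)
                  (∣-trans (∣⇒sq∣sq pᵉ∣tₘₙ) (t-sq∣t-+-sub-t k n′ (m * n)))
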